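{- Let $(V,\mathcal{F})$ be a split graph shelling antimatroid with $\mathcal{F}\neq 2^V$. Then there is a unique split graph $G$ (on vertex set $V$) such that $(V,\mathcal{F})$ is the split graph shelling antimatroid defined on $G$.
   Context: All graphs are finite and simple. A split graph is a graph whose vertex set can be partitioned into a clique and an independent set. A vertex is simplicial if its neighbours induce a clique. The split graph (vertex) shelling antimatroid defined on a split graph $G=(V,E)$ is $(V,\mathcal{F})$ where $F\subseteq V$ is feasible iff there is an ordering $(f_1,\dots,f_{|F|})$ of $F$ such that each $f_j$ is simplicial in $G\setminus\{f_1,\dots,f_{j-1}\}$. A split graph shelling antimatroid is a set system arising in this way from some split graph. $2^V$ denotes the power set of $V$. -}

module Defs where

open import Data.Nat using (ℕ)
open import Data.Fin using (Fin)
open import Data.Fin.Subset using (Subset; _∈_; _∉_; _∪_; ⁅_⁆; ⊥)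
open import Data.Bool using (Bool; true; false; T)
open import Data.List using (List; []; _∷_)
open import Data.Product using (Σ; ∃; _×_)
open import Data.Unit using (⊤)
open import Relation.Binary.PropositionalEquality using (_≡_; _≢_)
open import Relation.Nullary using (¬_)
open import Function.Bundles using (_⇔_)
import Data.List.Membership.Propositional as LM

record Graph (n : ℕ) : Set where
  field
    adj   : Fin n → Fin n → Bool
    sym   : ∀ u v → adj u v ≡ adj v u
    irrefl : ∀ v → adj v v ≡ false
open Graph public

Adj : {n : ℕ} → Graph n → Fin n → Fin n → Set
Adj G u v = T (adj G u v)

IsSplit : {n : ℕ} → Graph n → Set
IsSplit {n} G = Σ (Subset n) λ K →
  (∀ u v → u ∈ K → v ∈ K → u ≢ v → Adj G u v) ×
  (∀ u v → u ∉ K → v ∉ K → ¬ Adj G u v)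

-- v is simplicial in G ∖ R (R = set of already removed vertices):
-- v is a vertex of G ∖ R and its neighbours in G ∖ R induce a clique.
SimplicialIn : {n : ℕ} → Graph n → Subset n → Fin n → Set
SimplicialIn G R v = v ∉ R ×
  (∀ u w → u ∉ R → w ∉ R → Adj G v u → Adj G v w → u ≢ w → Adj G u w)

ShellSeq : {n : ℕ} → Graph n → Subset n → List (Fin n) → Set
ShellSeq G R []       = ⊤
ShellSeq G R (v ∷ vs) = SimplicialIn G R v × ShellSeq G (R ∪ ⁅ v ⁆) vs

Feasible : {n : ℕ} → Graph n → Subset n → Set
Feasible {n} G F = Σ (List (Fin n)) λ l →
  ShellSeq G ⊥ l × (∀ v → (v ∈ F) ⇔ (v LM.∈ l))

IsShellingOf : {n : ℕ} → (Subset n → Set) → Graph n → Set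
IsShellingOf 𝓕 G = ∀ F → 𝓕 F ⇔ Feasible G F

IsSplitShellingAntimatroid : {n : ℕ} → (Subset n → Set) → Set
IsSplitShellingAntimatroid {n} 𝓕 = Σ (Graph n) λ G → IsSplit G × IsShellingOf 𝓕 G

module Submission where

-- Two kinds of feasible sets detect the edges of a split graph G with
-- clique K.  (a) Obstructions: if z ≁ y and z, y are joined by an induced path
-- z-r-y or z-p-q-y, then V∖{z,y} is not feasible, because the first inner
-- vertex of the path to be removed still sees two non-adjacent survivors.  In
-- a split graph any two distinct non-adjacent non-isolated vertices are joined
-- by such a path.  (b) Constructions: if z is isolated, or z ∈ K and z ~ y,
-- then V∖{z,y} is feasible (remove F∖K, then the clique vertices not adjacent
-- to y, then the rest).  Now let G₁, G₂ be split graphs with the same feasible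
-- sets, G₁ not P₃-free (P₃-free graphs make every set feasible).  A vertex
-- that is non-isolated in G₁ cannot be isolated in G₂: otherwise (a), (b) and
-- the feasibility of {z} would force G₁ to be P₃-free.  Hence for an edge
-- z ~ y of G₁ with z ∈ K₁ that is not an edge of G₂, (b) in G₁ and (a) in G₂
-- contradict each other.  So adjacency is determined by 𝓕.

open import Defs
open import Data.Nat using (ℕ)
open import Data.Fin using (Fin)
open import Data.Fin.Subset using (Subset)
open import Data.Product using (Σ; _×_)
open import Relation.Binary.PropositionalEquality using (_≡_)
open import Relation.Nullary using (¬_)

open import Data.Bool using (T)
open import Data.Bool.Properties using (T-≡; ⇔→≡)
open import Data.Empty using () renaming (⊥-elim to absurd)
open import Data.Fin.Properties using (_≟_)
open import Data.Fin.Subset using (_∈_; _∉_; _∪_; ⁅_⁆; ∁; _⊆_) renaming (⊥ to ∅)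
open import Data.Fin.Subset.Properties
  using (_∈?_; ∉⊥; x∈⁅x⁆; x∈⁅y⁆⇒x≡y; x∈∁p⇒x∉p; x∉∁p⇒x∈p; x∉p⇒x∈∁p; x∈p∪q⁻; x∈p∪q⁺)
open import Data.List using (List; []; _∷_; _++_; filter; allFin)
open import Data.List.Membership.Propositional using () renaming (_∈_ to _∈ₗ_)
open import Data.List.Membership.Propositional.Properties
  using (∈-++⁺ˡ; ∈-++⁺ʳ; ∈-++⁻; ∈-filter⁺; ∈-filter⁻; ∈-allFin)
open import Data.List.Relation.Unary.Any using (here; there)
open import Data.List.Relation.Unary.All using () renaming (lookup to All-lookup)
open import Data.List.Relation.Unary.AllPairs using (_∷_)
open import Data.List.Relation.Unary.Unique.Propositional using (Unique)
open import Data.List.Relation.Unary.Unique.Propositional.Properties using (allFin⁺; filter⁺)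
open import Data.Product using (_,_; proj₁; proj₂; Σ-syntax)
open import Data.Sum using (_⊎_; inj₁; inj₂)
open import Data.Unit using (tt)
open import Function.Bundles using (_⇔_; Equivalence; mk⇔)
import Function.Properties.Equivalence as ⇔
open import Relation.Binary.PropositionalEquality using (refl; subst; _≢_) renaming (sym to ≡-sym)
open import Relation.Nullary using (yes; no)
open import Relation.Nullary.Decidable using (T?; _×-dec_; ¬?)
open import Relation.Unary using (Pred; Decidable)
open import Level using (0ℓ)

∉-∪⁅⁆ : ∀ {n} {R : Subset n} {v x : Fin n} → x ∉ R → x ≢ v → x ∉ R ∪ ⁅ v ⁆
∉-∪⁅⁆ {R = R} {v} x∉R x≢v x∈ with x∈p∪q⁻ R ⁅ v ⁆ x∈
... | inj₁ x∈R = x∉R x∈R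
... | inj₂ x∈v = x≢v (x∈⁅y⁆⇒x≡y v x∈v)

allBut : ∀ {n} → Fin n → Fin n → Subset n
allBut z y = ∁ (⁅ z ⁆ ∪ ⁅ y ⁆)

z∉allBut : ∀ {n} {z y : Fin n} → z ∉ allBut z y
z∉allBut {z = z} z∈ = x∈∁p⇒x∉p z∈ (x∈p∪q⁺ (inj₁ (x∈⁅x⁆ z)))

y∉allBut : ∀ {n} {z y : Fin n} → y ∉ allBut z y
y∉allBut {y = y} y∈ = x∈∁p⇒x∉p y∈ (x∈p∪q⁺ (inj₂ (x∈⁅x⁆ y)))

∈-allBut : ∀ {n} {z y x : Fin n} → x ≢ z → x ≢ y → x ∈ allBut z y
∈-allBut {z = z} {y} x≢z x≢y = x∉p⇒x∈∁p λ x∈ → ∉-∪⁅⁆ (λ x∈z → x≢z (x∈⁅y⁆⇒x≡y z x∈z)) x≢y x∈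

∉-allBut : ∀ {n} {z y x : Fin n} → x ∉ allBut z y → x ≡ z ⊎ x ≡ y
∉-allBut {z = z} {y} x∉ with x∈p∪q⁻ ⁅ z ⁆ ⁅ y ⁆ (x∉∁p⇒x∈p x∉)
... | inj₁ x∈z = inj₁ (x∈⁅y⁆⇒x≡y z x∈z)
... | inj₂ x∈y = inj₂ (x∈⁅y⁆⇒x≡y y x∈y)

∈-tail : ∀ {n} {r v : Fin n} {vs} → r ∈ₗ v ∷ vs → r ≢ v → r ∈ₗ vs
∈-tail (here r≡v) r≢v = absurd (r≢v r≡v)
∈-tail (there r∈) _   = r∈

listOf : ∀ {n} {P : Pred (Fin n) 0ℓ} → Decidable P → List (Fin n)
listOf P? = filter P? (allFin _)

∈-listOf⁺ : ∀ {n} {P : Pred (Fin n) 0ℓ} (P? : Decidable P) {x} → P x → x ∈ₗ listOf P?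
∈-listOf⁺ P? {x} = ∈-filter⁺ P? (∈-allFin x)

∈-listOf⁻ : ∀ {n} {P : Pred (Fin n) 0ℓ} (P? : Decidable P) {x} → x ∈ₗ listOf P? → P x
∈-listOf⁻ P? x∈ = proj₂ (∈-filter⁻ P? {xs = allFin _} x∈)

module _ {n : ℕ} (G : Graph n) where

  adjSym : ∀ {u v} → Adj G u v → Adj G v u
  adjSym {u} {v} = subst T (sym G u v)

  adj⇒≢ : ∀ {u v} → Adj G u v → u ≢ v
  adj⇒≢ {u} uv refl = subst T (irrefl G u) uv

  Isolated : Fin n → Set
  Isolated v = ∀ w → ¬ Adj G v w

  CliqueNbhd : Subset n → Fin n → Set
  CliqueNbhd R v = ∀ u w → u ∉ R → w ∉ R → Adj G v u → Adj G v w → u ≢ w → Adj G u w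

  SimplicialFrom : Subset n → Fin n → Set
  SimplicialFrom R v = ∀ R' → R ⊆ R' → CliqueNbhd R' v

  removeAll : Subset n → List (Fin n) → Subset n
  removeAll R []       = R
  removeAll R (v ∷ vs) = removeAll (R ∪ ⁅ v ⁆) vs

  removeAll-⊇R : ∀ R l {x} → x ∈ R → x ∈ removeAll R l
  removeAll-⊇R R []       x∈R = x∈R
  removeAll-⊇R R (v ∷ vs) x∈R = removeAll-⊇R (R ∪ ⁅ v ⁆) vs (x∈p∪q⁺ (inj₁ x∈R))

  removeAll-⊇l : ∀ R l {x} → x ∈ₗ l → x ∈ removeAll R l
  removeAll-⊇l R (v ∷ vs) (here refl) = removeAll-⊇R (R ∪ ⁅ v ⁆) vs (x∈p∪q⁺ (inj₂ (x∈⁅x⁆ v)))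
  removeAll-⊇l R (v ∷ vs) (there x∈) = removeAll-⊇l (R ∪ ⁅ v ⁆) vs x∈

  removeAll-⊆ : ∀ R l {x} → x ∈ removeAll R l → x ∈ R ⊎ x ∈ₗ l
  removeAll-⊆ R []       x∈ = inj₁ x∈
  removeAll-⊆ R (v ∷ vs) x∈ with removeAll-⊆ (R ∪ ⁅ v ⁆) vs x∈
  ... | inj₂ x∈vs = inj₂ (there x∈vs)
  ... | inj₁ x∈R∪v with x∈p∪q⁻ R ⁅ v ⁆ x∈R∪v
  ...   | inj₁ x∈R = inj₁ x∈R
  ...   | inj₂ x∈v = inj₂ (here (x∈⁅y⁆⇒x≡y v x∈v))

  shell-++ : ∀ R l₁ l₂ → ShellSeq G R l₁ → ShellSeq G (removeAll R l₁) l₂ → ShellSeq G R (l₁ ++ l₂)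
  shell-++ R []       l₂ _         s₂ = s₂
  shell-++ R (v ∷ vs) l₂ (sv , s₁) s₂ = sv , shell-++ (R ∪ ⁅ v ⁆) vs l₂ s₁ s₂

  shellDistinct : ∀ R l → Unique l → (∀ {v} → v ∈ₗ l → v ∉ R) →
                  (∀ {v} → v ∈ₗ l → SimplicialFrom R v) → ShellSeq G R l
  shellDistinct R []       _               _     _    = tt
  shellDistinct R (v ∷ vs) (v∉vs ∷ uniq) fresh simp =
    (fresh (here refl) , simp (here refl) R (λ x∈ → x∈)) ,
    shellDistinct (R ∪ ⁅ v ⁆) vs uniq
      (λ x∈ → ∉-∪⁅⁆ (fresh (there x∈)) (λ x≡v → All-lookup v∉vs x∈ (≡-sym x≡v)))
      (λ x∈ R' R∪v⊆R' → simp (there x∈) R' (λ p → R∪v⊆R' (x∈p∪q⁺ (inj₁ p))))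

  shellPhase : ∀ R {P : Pred (Fin n) 0ℓ} (P? : Decidable P) → (∀ {v} → P v → v ∉ R) →
               (∀ {v} → P v → SimplicialFrom R v) → ShellSeq G R (listOf P?)
  shellPhase R P? fresh simp =
    shellDistinct R (listOf P?) (filter⁺ P? (allFin⁺ n))
      (λ v∈ → fresh (∈-listOf⁻ P? v∈)) (λ v∈ → simp (∈-listOf⁻ P? v∈))

  commonNeighbourBlocks : ∀ R l → ShellSeq G R l → ∀ {x y r} → x ∉ R → y ∉ R →
    ¬ x ∈ₗ l → ¬ y ∈ₗ l → r ∈ₗ l → x ≢ y → Adj G r x → Adj G r y → Adj G x y
  commonNeighbourBlocks R (v ∷ vs) ((_ , clq) , s) {x} {y} {r} x∉R y∉R x∉l y∉l r∈l x≢y rx ry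
    with r ≟ v
  ... | yes refl = clq x y x∉R y∉R rx ry x≢y
  ... | no r≢v = commonNeighbourBlocks (R ∪ ⁅ v ⁆) vs s
                   (∉-∪⁅⁆ x∉R (λ e → x∉l (here e))) (∉-∪⁅⁆ y∉R (λ e → y∉l (here e)))
                   (λ x∈ → x∉l (there x∈)) (λ y∈ → y∉l (there y∈)) (∈-tail r∈l r≢v) x≢y rx ry

  -- For a path x-p-q-y with x ≁ q whose inner vertices occur in a shelling
  -- sequence and whose ends never do, p ~ y: p cannot be removed before q
  -- (x ≁ q), and when q is removed p and y are neighbours of q.
  inducedP₄Blocks : ∀ R l → ShellSeq G R l → ∀ {x y p q} → x ∉ R → y ∉ R → p ∉ R → q ∉ R →
    ¬ x ∈ₗ l → ¬ y ∈ₗ l → p ∈ₗ l → q ∈ₗ l →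
    Adj G x p → Adj G p q → Adj G q y → ¬ Adj G x q → Adj G p y
  inducedP₄Blocks R (v ∷ vs) ((_ , clq) , s) {x} {y} {p} {q} x∉R y∉R p∉R q∉R x∉l y∉l p∈l q∈l xp pq qy x≁q
    with p ≟ v | q ≟ v
  ... | yes refl | _ = absurd (x≁q (clq x q x∉R q∉R (adjSym xp) pq x≢q))
    where x≢q : x ≢ q
          x≢q refl = x∉l q∈l
  ... | no _ | yes refl = clq p y p∉R y∉R (adjSym pq) qy p≢y
    where p≢y : p ≢ y
          p≢y refl = y∉l p∈l
  ... | no p≢v | no q≢v = inducedP₄Blocks (R ∪ ⁅ v ⁆) vs s
        (∉-∪⁅⁆ x∉R (λ e → x∉l (here e))) (∉-∪⁅⁆ y∉R (λ e → y∉l (here e)))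
        (∉-∪⁅⁆ p∉R p≢v) (∉-∪⁅⁆ q∉R q≢v)
        (λ x∈ → x∉l (there x∈)) (λ y∈ → y∉l (there y∈)) (∈-tail p∈l p≢v) (∈-tail q∈l q≢v)
        xp pq qy x≁q

  commonNeighbourInfeasible : ∀ {F} → Feasible G F → ∀ {x y r} → x ∉ F → y ∉ F → r ∈ F →
    x ≢ y → Adj G r x → Adj G r y → Adj G x y
  commonNeighbourInfeasible (l , s , F≡l) {x} {y} {r} x∉F y∉F r∈F =
    commonNeighbourBlocks ∅ l s ∉⊥ ∉⊥
      (λ x∈ → x∉F (Equivalence.from (F≡l x) x∈)) (λ y∈ → y∉F (Equivalence.from (F≡l y) y∈))
      (Equivalence.to (F≡l r) r∈F)

  inducedP₄Infeasible : ∀ {F} → Feasible G F → ∀ {x y p q} → x ∉ F → y ∉ F → p ∈ F → q ∈ F →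
    Adj G x p → Adj G p q → Adj G q y → ¬ Adj G x q → Adj G p y
  inducedP₄Infeasible (l , s , F≡l) {x} {y} {p} {q} x∉F y∉F p∈F q∈F =
    inducedP₄Blocks ∅ l s ∉⊥ ∉⊥ ∉⊥ ∉⊥
      (λ x∈ → x∉F (Equivalence.from (F≡l x) x∈)) (λ y∈ → y∉F (Equivalence.from (F≡l y) y∈))
      (Equivalence.to (F≡l p) p∈F) (Equivalence.to (F≡l q) q∈F)

  ShortPath : Fin n → Fin n → Set
  ShortPath z y = (Σ[ r ∈ Fin n ] (Adj G z r × Adj G r y)) ⊎
                  (Σ[ p ∈ Fin n ] Σ[ q ∈ Fin n ]
                     (Adj G z p × Adj G p q × Adj G q y × ¬ Adj G z q × ¬ Adj G p y))

  allBut-infeasible : ∀ {z y} → z ≢ y → ¬ Adj G z y → ShortPath z y → ¬ Feasible G (allBut z y)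
  allBut-infeasible z≢y z≁y (inj₁ (r , zr , ry)) f =
    z≁y (commonNeighbourInfeasible f z∉allBut y∉allBut
      (∈-allBut (λ r≡z → adj⇒≢ zr (≡-sym r≡z)) (adj⇒≢ ry)) z≢y (adjSym zr) ry)
  allBut-infeasible {z} {y} z≢y z≁y (inj₂ (p , q , zp , pq , qy , z≁q , p≁y)) f =
    p≁y (inducedP₄Infeasible f z∉allBut y∉allBut
      (∈-allBut (λ p≡z → adj⇒≢ zp (≡-sym p≡z)) (λ p≡y → z≁y (subst (Adj G z) p≡y zp)))
      (∈-allBut (λ q≡z → z≁y (subst (λ w → Adj G w y) q≡z qy)) (adj⇒≢ qy))
      zp pq qy z≁q)

  P₃Free : Set
  P₃Free = ∀ a w b → a ≢ b → Adj G w a → Adj G w b → Adj G a b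

  p₃Free⇒allFeasible : P₃Free → ∀ F → Feasible G F
  p₃Free⇒allFeasible p₃Free F =
    listOf (_∈? F) ,
    shellPhase ∅ (_∈? F) (λ _ → ∉⊥) (λ _ _ _ u w _ _ vu vw u≢w → p₃Free u _ w u≢w vu vw) ,
    λ v → mk⇔ (∈-listOf⁺ (_∈? F)) (∈-listOf⁻ (_∈? F))

  isolated⇒singletonFeasible : ∀ z → Isolated z → Feasible G ⁅ z ⁆
  isolated⇒singletonFeasible z iso =
    z ∷ [] , ((∉⊥ , λ u _ _ _ zu _ _ → absurd (iso u zu)) , tt) ,
    λ v → mk⇔ (λ v∈ → here (x∈⁅y⁆⇒x≡y z v∈)) λ { (here refl) → x∈⁅x⁆ z }

  -- If {z} is feasible and z is adjacent to every other non-isolated vertex,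
  -- then G is P₃-free: an induced a-w-b would have to pass through z, or put
  -- two non-adjacent neighbours on z.
  centralSingleton⇒p₃Free : ∀ {z} → Feasible G ⁅ z ⁆ →
    (∀ y w → Adj G y w → z ≡ y ⊎ Adj G z y) → P₃Free
  centralSingleton⇒p₃Free {z} f central a w b a≢b wa wb
    with central a w (adjSym wa) | central b w (adjSym wb)
  ... | inj₁ refl | inj₁ refl = absurd (a≢b refl)
  ... | inj₁ refl | inj₂ zb   = zb
  ... | inj₂ za   | inj₁ refl = adjSym za
  ... | inj₂ za   | inj₂ zb   = commonNeighbourInfeasible f (notZ za) (notZ zb) (x∈⁅x⁆ z) a≢b za zb
    where
    notZ : ∀ {x} → Adj G z x → x ∉ ⁅ z ⁆
    notZ zx x∈ = adj⇒≢ zx (≡-sym (x∈⁅y⁆⇒x≡y z x∈))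

  module Split (K : Subset n)
               (clique : ∀ u v → u ∈ K → v ∈ K → u ≢ v → Adj G u v)
               (indep : ∀ u v → u ∉ K → v ∉ K → ¬ Adj G u v) where

    nbrInK : ∀ {u v} → u ∉ K → Adj G u v → v ∈ K
    nbrInK {u} {v} u∉K uv with v ∈? K
    ... | yes v∈K = v∈K
    ... | no v∉K = absurd (indep u v u∉K v∉K uv)

    edgeMeetsK : ∀ {u v} → Adj G u v → (u ∈ K × Adj G u v) ⊎ (v ∈ K × Adj G v u)
    edgeMeetsK {u} uv with u ∈? K
    ... | yes u∈K = inj₁ (u∈K , uv)
    ... | no u∉K  = inj₂ (nbrInK u∉K uv , adjSym uv)

    -- Distinct non-adjacent non-isolated vertices are joined by a short path:
    -- through K when one of them lies in K, else through their neighbours t, s ∈ K.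
    shortPath : ∀ {z t y s} → Adj G z t → Adj G y s → z ≢ y → ¬ Adj G z y → ShortPath z y
    shortPath {z} {t} {y} {s} zt ys z≢y z≁y with z ∈? K | y ∈? K
    ... | yes z∈K | yes y∈K = absurd (z≁y (clique z y z∈K y∈K z≢y))
    ... | yes z∈K | no y∉K  =
      inj₁ (s , clique z s z∈K (nbrInK y∉K ys) (λ { refl → z≁y (adjSym ys) }) , adjSym ys)
    ... | no z∉K  | yes y∈K = inj₁ (t , zt , clique t y (nbrInK z∉K zt) y∈K (λ { refl → z≁y zt }))
    ... | no z∉K  | no y∉K with T? (adj G t y) | T? (adj G z s)
    ...   | yes ty | _      = inj₁ (t , zt , ty)
    ...   | no _   | yes zs = inj₁ (s , zs , adjSym ys)
    ...   | no t≁y | no z≁s with t ≟ s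
    ...     | yes refl = absurd (t≁y (adjSym ys))
    ...     | no t≢s   =
      inj₂ (t , s , zt , clique t s (nbrInK z∉K zt) (nbrInK y∉K ys) t≢s , adjSym ys , z≁s , t≁y)

    -- Remove the loose vertices
    -- F ∖ K, then the far clique vertices (not adjacent to y), then the near ones.
    module NearY (F : Subset n) (y : Fin n)
                 (outside : ∀ x → x ∉ F → x ≢ y → Isolated x ⊎ (x ∈ K × Adj G x y)) where

      Loose Far Near : Pred (Fin n) 0ℓ
      Loose x = x ∈ F × x ∉ K
      Far   x = x ∈ F × x ∈ K × ¬ Adj G x y
      Near  x = x ∈ F × x ∈ K × Adj G x y

      loose? : Decidable Loose
      loose? x = (x ∈? F) ×-dec ¬? (x ∈? K)
      far? : Decidable Far
      far? x = (x ∈? F) ×-dec ((x ∈? K) ×-dec ¬? (T? (adj G x y)))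
      near? : Decidable Near
      near? x = (x ∈? F) ×-dec ((x ∈? K) ×-dec T? (adj G x y))

      R₁ R₂ : Subset n
      R₁ = removeAll ∅ (listOf loose?)
      R₂ = removeAll R₁ (listOf far?)

      loose⊆R₁ : ∀ {x} → Loose x → x ∈ R₁
      loose⊆R₁ l = removeAll-⊇l ∅ (listOf loose?) (∈-listOf⁺ loose? l)

      far⊆R₂ : ∀ {x} → Far x → x ∈ R₂
      far⊆R₂ f = removeAll-⊇l R₁ (listOf far?) (∈-listOf⁺ far? f)

      K∩R₁≡∅ : ∀ {x} → x ∈ K → x ∉ R₁
      K∩R₁≡∅ x∈K x∈ with removeAll-⊆ ∅ (listOf loose?) x∈
      ... | inj₁ x∈∅ = ∉⊥ x∈∅
      ... | inj₂ x∈l = proj₂ (∈-listOf⁻ loose? x∈l) x∈K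

      near∉R₂ : ∀ {x} → Near x → x ∉ R₂
      near∉R₂ (_ , x∈K , xy) x∈ with removeAll-⊆ R₁ (listOf far?) x∈
      ... | inj₁ x∈R₁ = K∩R₁≡∅ x∈K x∈R₁
      ... | inj₂ x∈l  = proj₂ (proj₂ (∈-listOf⁻ far? x∈l)) xy

      survivor : ∀ R' → R₁ ⊆ R' → ∀ {v u} → Adj G v u → u ∉ R' → u ∈ K ⊎ u ≡ y
      survivor R' R₁⊆R' {v} {u} vu u∉R' with u ∈? K
      ... | yes u∈K = inj₁ u∈K
      ... | no u∉K with u ∈? F
      ...   | yes u∈F = absurd (u∉R' (R₁⊆R' (loose⊆R₁ (u∈F , u∉K))))
      ...   | no u∉F with u ≟ y
      ...     | yes u≡y = inj₂ u≡y
      ...     | no u≢y with outside u u∉F u≢y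
      ...       | inj₁ iso = absurd (iso v (adjSym vu))
      ...       | inj₂ (u∈K , _) = absurd (u∉K u∈K)

      survivorNearY : ∀ R' → R₂ ⊆ R' → ∀ {v w} → Adj G v w → w ∈ K → w ∉ R' → w ≢ y → Adj G w y
      survivorNearY R' R₂⊆R' {v} {w} vw w∈K w∉R' w≢y with w ∈? F
      ... | yes w∈F with T? (adj G w y)
      ...   | yes wy = wy
      ...   | no w≁y = absurd (w∉R' (R₂⊆R' (far⊆R₂ (w∈F , w∈K , w≁y))))
      survivorNearY R' R₂⊆R' {v} {w} vw w∈K w∉R' w≢y | no w∉F with outside w w∉F w≢y
      ...   | inj₁ iso = absurd (iso v (adjSym vw))
      ...   | inj₂ (_ , wy) = wy

      looseSimplicial : ∀ {v} → Loose v → SimplicialFrom ∅ v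
      looseSimplicial (_ , v∉K) _ _ u w _ _ vu vw u≢w = clique u w (nbrInK v∉K vu) (nbrInK v∉K vw) u≢w

      farSimplicial : ∀ {v} → Far v → SimplicialFrom R₁ v
      farSimplicial (_ , _ , v≁y) R' R₁⊆R' u w u∉R' w∉R' vu vw u≢w
        with survivor R' R₁⊆R' vu u∉R' | survivor R' R₁⊆R' vw w∉R'
      ... | inj₂ refl | _         = absurd (v≁y vu)
      ... | inj₁ _    | inj₂ refl = absurd (v≁y vw)
      ... | inj₁ u∈K  | inj₁ w∈K  = clique u w u∈K w∈K u≢w

      nearSimplicial : ∀ {v} → Near v → SimplicialFrom R₂ v
      nearSimplicial _ R' R₂⊆R' u w u∉R' w∉R' vu vw u≢w
        with survivor R' (λ x∈ → R₂⊆R' (removeAll-⊇R R₁ (listOf far?) x∈)) vu u∉R'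
           | survivor R' (λ x∈ → R₂⊆R' (removeAll-⊇R R₁ (listOf far?) x∈)) vw w∉R'
      ... | inj₁ u∈K  | inj₁ w∈K  = clique u w u∈K w∈K u≢w
      ... | inj₂ refl | inj₂ refl = absurd (u≢w refl)
      ... | inj₂ refl | inj₁ w∈K  = adjSym (survivorNearY R' R₂⊆R' vw w∈K w∉R' (λ w≡u → u≢w (≡-sym w≡u)))
      ... | inj₁ u∈K  | inj₂ refl = survivorNearY R' R₂⊆R' vu u∈K u∉R' u≢w

      order : List (Fin n)
      order = listOf loose? ++ listOf far? ++ listOf near?

      order⊆F : ∀ {x} → x ∈ₗ order → x ∈ F
      order⊆F x∈ with ∈-++⁻ (listOf loose?) x∈
      ... | inj₁ x∈l = proj₁ (∈-listOf⁻ loose? x∈l)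
      ... | inj₂ x∈' with ∈-++⁻ (listOf far?) x∈'
      ...   | inj₁ x∈f = proj₁ (∈-listOf⁻ far? x∈f)
      ...   | inj₂ x∈n = proj₁ (∈-listOf⁻ near? x∈n)

      F⊆order : ∀ {x} → x ∈ F → x ∈ₗ order
      F⊆order {x} x∈F with x ∈? K
      ... | no x∉K = ∈-++⁺ˡ (∈-listOf⁺ loose? (x∈F , x∉K))
      ... | yes x∈K with T? (adj G x y)
      ...   | no x≁y = ∈-++⁺ʳ (listOf loose?) (∈-++⁺ˡ (∈-listOf⁺ far? (x∈F , x∈K , x≁y)))
      ...   | yes xy = ∈-++⁺ʳ (listOf loose?) (∈-++⁺ʳ (listOf far?) (∈-listOf⁺ near? (x∈F , x∈K , xy)))

      feasible : Feasible G F
      feasible = order ,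
        shell-++ ∅ (listOf loose?) _
          (shellPhase ∅ loose? (λ _ → ∉⊥) looseSimplicial)
          (shell-++ R₁ (listOf far?) _
             (shellPhase R₁ far? (λ (_ , x∈K , _) → K∩R₁≡∅ x∈K) farSimplicial)
             (shellPhase R₂ near? near∉R₂ nearSimplicial)) ,
        λ v → mk⇔ F⊆order order⊆F

    allBut-feasible : ∀ z y → Isolated z ⊎ (z ∈ K × Adj G z y) → Feasible G (allBut z y)
    allBut-feasible z y zOk = NearY.feasible (allBut z y) y outside
      where
      outside : ∀ x → x ∉ allBut z y → x ≢ y → Isolated x ⊎ (x ∈ K × Adj G x y)
      outside x x∉ x≢y with ∉-allBut x∉
      ... | inj₁ refl = zOk
      ... | inj₂ x≡y  = absurd (x≢y x≡y)

module EdgeTransfer {n : ℕ} (G₁ G₂ : Graph n) (split₁ : IsSplit G₁) (split₂ : IsSplit G₂)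
                    (same : ∀ F → Feasible G₁ F ⇔ Feasible G₂ F) (notP₃Free : ¬ P₃Free G₁) where

  open Split G₁ (proj₁ split₁) (proj₁ (proj₂ split₁)) (proj₂ (proj₂ split₁))
    renaming (shortPath to shortPath₁; allBut-feasible to allBut-feasible₁; edgeMeetsK to edgeMeetsK₁)
  open Split G₂ (proj₁ split₂) (proj₁ (proj₂ split₂)) (proj₂ (proj₂ split₂))
    renaming (shortPath to shortPath₂; allBut-feasible to allBut-feasible₂)

  -- Otherwise {z} is
  -- feasible, and every other non-isolated y ≁ z of G₁ would make V ∖ {z,y}
  -- feasible by (b) in G₂ yet infeasible by (a) in G₁; so G₁ would be P₃-free.
  nonIsolated : ∀ {z t} → Adj G₁ z t → ¬ Isolated G₂ z
  nonIsolated {z} zt iso = notP₃Free (centralSingleton⇒p₃Free G₁ singleton central)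
    where
    singleton : Feasible G₁ ⁅ z ⁆
    singleton = Equivalence.from (same _) (isolated⇒singletonFeasible G₂ z iso)

    central : ∀ y w → Adj G₁ y w → z ≡ y ⊎ Adj G₁ z y
    central y w yw with z ≟ y
    ... | yes z≡y = inj₁ z≡y
    ... | no z≢y with T? (adj G₁ z y)
    ...   | yes zy = inj₂ zy
    ...   | no z≁y = absurd (allBut-infeasible G₁ z≢y z≁y (shortPath₁ zt yw z≢y z≁y)
                       (Equivalence.from (same _) (allBut-feasible₂ z y (inj₁ iso))))

  -- The edge z ~ y with z ∈ K₁ makes V ∖ {z,y} feasible in G₁ by (b); if z ≁ y
  -- in G₂, both ends are non-isolated there, so (a) makes it infeasible in G₂.
  cliqueEdge : ∀ {z y} → z ∈ proj₁ split₁ × Adj G₁ z y → Adj G₂ z y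
  cliqueEdge {z} {y} (z∈K , zy) with T? (adj G₂ z y)
  ... | yes zy₂ = zy₂
  ... | no z≁y₂ =
    absurd (nonIsolated zy λ s zs → nonIsolated (adjSym G₁ zy) λ s' ys' →
      allBut-infeasible G₂ z≢y z≁y₂ (shortPath₂ zs ys' z≢y z≁y₂) feasible₂)
    where
    z≢y : z ≢ y
    z≢y = adj⇒≢ G₁ zy
    feasible₂ : Feasible G₂ (allBut z y)
    feasible₂ = Equivalence.to (same _) (allBut-feasible₁ z y (inj₂ (z∈K , zy)))

  edge : ∀ {u v} → Adj G₁ u v → Adj G₂ u v
  edge uv with edgeMeetsK₁ uv
  ... | inj₁ e = cliqueEdge e
  ... | inj₂ e = adjSym G₂ (cliqueEdge e)

mainTheorem5 : (n : ℕ) (𝓕 : Subset n → Set) →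
    IsSplitShellingAntimatroid 𝓕 →
    ¬ (∀ F → 𝓕 F) →
    Σ (Graph n) λ G → (IsSplit G × IsShellingOf 𝓕 G) ×
      (∀ (H : Graph n) → IsSplit H → IsShellingOf 𝓕 H →
        ∀ u v → adj H u v ≡ adj G u v)
mainTheorem5 n 𝓕 (G , splitG , shellG) notAll = G , (splitG , shellG) , unique
  where
  notP₃Free : ∀ {H} → IsShellingOf 𝓕 H → ¬ P₃Free H
  notP₃Free {H} shellH p₃Free = notAll λ F → Equivalence.from (shellH F) (p₃Free⇒allFeasible H p₃Free F)

  unique : ∀ (H : Graph n) → IsSplit H → IsShellingOf 𝓕 H → ∀ u v → adj H u v ≡ adj G u v
  unique H splitH shellH u v = ⇔→≡ (⇔.trans (⇔.sym T-≡) (⇔.trans (mk⇔ H⇒G G⇒H) T-≡))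
    where
    sameHG : ∀ F → Feasible H F ⇔ Feasible G F
    sameHG F = ⇔.trans (⇔.sym (shellH F)) (shellG F)
    H⇒G : Adj H u v → Adj G u v
    H⇒G = EdgeTransfer.edge H G splitH splitG sameHG (notP₃Free shellH)
    G⇒H : Adj G u v → Adj H u v
    G⇒H = EdgeTransfer.edge G H splitG splitH (λ F → ⇔.sym (sameHG F)) (notP₃Free shellG)
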